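{- Let $q>2$ be a prime power and $k$ a positive integer. Define $F:\mathbb{F}_q^k\to\mathbb{F}_q^k$ by $F(a_1,\dots,a_k)=(b_1,\dots,b_k)$, where $b_i:=c_{i,i}$ and, for each fixed $1\le i\le k$, the elements $c_{i,j}$ ($0\le j\le i$) are defined by $c_{i,0}:=0$ and $c_{i,j}:=c_{i,j-1}^{q-2}+a_{i-j+1}$. For $2\le \ell\le k$ define $\Phi_\ell:\mathbb{F}_q^\ell\to\mathbb{F}_q^{\ell-1}$ by $\Phi_\ell(e_1,\dots,e_\ell)=((e_2-e_1)^{q-2},(e_3-e_1)^{q-2},\dots,(e_\ell-e_1)^{q-2})$, and let $\Phi^{i-1}:=\Phi_{k-i+2}\circ\Phi_{k-i+3}\circ\cdots\circ\Phi_k:\mathbb{F}_q^k\to\mathbb{F}_q^{k-i+1}$ for $1\le i\le k$ (with $\Phi^0$ the identity). Define $G:\mathbb{F}_q^k\to\mathbb{F}_q^k$ by $G(b_1,\dots,b_k)=(a_1,\dots,a_k)$, where $a_i$ is the first entry of $\Phi^{i-1}(b_1,\dots,b_k)$. Then $F$ and $G$ are inverses of one another; in particular both are bijections of $\mathbb{F}_q^k$.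
   Context: For $c\in\mathbb{F}_q$, $c^{q-2}$ is the ordinary power in $\mathbb{F}_q$ (so $0^{q-2}=0$ and $c^{q-2}=c^{ -1}$ for $c\ne0$). -}

module Defs where

open import Level using (0ℓ)
open import Data.Nat using (ℕ; zero; suc; _∸_; _≤_; _<_; _<?_; _^_)
open import Data.Nat.Primality using (Prime)
open import Data.Fin using (Fin; toℕ; fromℕ<) renaming (zero to fzero; suc to fsuc)
open import Data.Product using (∃; ∃₂; _×_)
open import Function.Bundles using (_↔_)
open import Relation.Binary.PropositionalEquality using (_≡_; _≢_)
open import Relation.Nullary using (yes; no)
open import Algebra.Structures using (IsCommutativeRing)

IsPrimePower : ℕ → Set
IsPrimePower q = ∃₂ λ p n → Prime p × 1 ≤ n × q ≡ p ^ n

record FiniteField (q : ℕ) : Set₁ where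
  infixl 6 _+_ _-_
  infixl 7 _*_
  field
    Carrier : Set
    _+_ _*_ : Carrier → Carrier → Carrier
    -_ : Carrier → Carrier
    0# 1# : Carrier
    isCommutativeRing : IsCommutativeRing _≡_ _+_ _*_ -_ 0# 1#
    0≢1 : 0# ≢ 1#
    inverse : ∀ x → x ≢ 0# → ∃ λ y → x * y ≡ 1#
    enumeration : Fin q ↔ Carrier

  _-_ : Carrier → Carrier → Carrier
  x - y = x + (- y)

  _^ᶠ_ : Carrier → ℕ → Carrier
  x ^ᶠ zero = 1#
  x ^ᶠ suc n = x * (x ^ᶠ n)

module Maps {q : ℕ} (K : FiniteField q) where
  open FiniteField K

  inv : Carrier → Carrier
  inv c = c ^ᶠ (q ∸ 2)

  -- vectors in F_q^k are functions Fin k → F_q; index 0-based (Fin k entry t is a_{t+1})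
  -- a_m for 1-based m (only used for 1 ≤ m ≤ k; defaults to 0 otherwise)
  entry : {k : ℕ} → (Fin k → Carrier) → ℕ → Carrier
  entry {k} a zero = 0#
  entry {k} a (suc m) with m <? k
  ... | yes m<k = a (fromℕ< m<k)
  ... | no _ = 0#

  c : {k : ℕ} → (Fin k → Carrier) → ℕ → ℕ → Carrier
  c a i zero = 0#
  c a i (suc j) = inv (c a i j) + entry a (i ∸ j)

  -- F(a)_i = c_{i,i}   (0-based t corresponds to i = t+1)
  F : {k : ℕ} → (Fin k → Carrier) → (Fin k → Carrier)
  F a t = c a (suc (toℕ t)) (suc (toℕ t))

  Φ : {m : ℕ} → (Fin (suc m) → Carrier) → (Fin m → Carrier)
  Φ e j = inv (e (fsuc j) - e fzero)

  -- G(b)_i = first entry of Φ^{i-1}(b), where Φ^{i-1} = Φ_{k-i+2} ∘ ⋯ ∘ Φ_k: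
  -- first entry of Φ^0(b) = b is b_1; the (i+1)-th entry is the first entry of Φ^{i-1}(Φ_k b).
  G : {k : ℕ} → (Fin k → Carrier) → (Fin k → Carrier)
  G {suc m} b fzero = b fzero
  G {suc m} b (fsuc j) = G {m} (Φ b) j

{-# OPTIONS --safe #-}
-- Since q > 2, the map c ↦ c^(q-2) fixes 0 and, by Fermat's little theorem, inverts every
-- nonzero element, so it is an involution ι. Unwinding the recursion for c_{i,j} gives
-- F(a)_1 = a_1 and F(a)_{t+1} = ι(F(a_2,…,a_k)_t) + a_1, a continued fraction in a_1, a_2, ….
-- Hence Φ_k(F(a)) = F(a_2,…,a_k), while G(b) = (b_1, G(Φ_k b)) by definition, so G ∘ F = id
-- and F ∘ G = id follow by induction on k.
module Submission where

open import Defs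
open import Data.Nat using (ℕ; zero; suc; _∸_; _<_; _≤_; _<?_; z≤n; s≤s)
open import Data.Nat.Properties using (<⇒≤; ≤-refl; m+n∸n≡m)
open import Data.Fin using (Fin; toℕ; punchIn) renaming (zero to fzero; suc to fsuc)
open import Data.Fin.Properties using (toℕ-injective; toℕ-fromℕ<; punchInᵢ≢i)
import Data.Fin.Properties as Fin
open import Data.Fin.Permutation using (Permutation′; _⟨$⟩ʳ_)
open import Data.Vec.Functional using (Vector; head; tail; removeAt)
open import Data.Product using (_×_; _,_; proj₁; proj₂)
open import Data.Empty using (⊥-elim)
open import Function.Base using (_∘_)
open import Function.Bundles using (Inverse; _↔_; mk↔ₛ′)
open import Function.Properties.Inverse using (↔-sym; ↔-trans; ↔⇒↣)
open import Relation.Nullary using (yes; no)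
open import Relation.Nullary.Decidable using (via-injection)
open import Relation.Binary.Definitions using (DecidableEquality)
open import Relation.Binary.PropositionalEquality
open import Algebra.Structures using (IsCommutativeRing)
open import Algebra.Bundles using (CommutativeRing)
import Algebra.Properties.Group as GroupProperties
import Algebra.Properties.CommutativeMonoid.Sum as ProductProperties

module FiniteFieldProperties {q : ℕ} (K : FiniteField q) where
  open FiniteField K public
  open IsCommutativeRing isCommutativeRing public
    using (+-identityˡ; *-comm; *-assoc; *-identityˡ; *-identityʳ; zeroˡ; zeroʳ)

  commutativeRing : CommutativeRing _ _
  commutativeRing = record
    { Carrier = Carrier ; _≈_ = _≡_ ; _+_ = _+_ ; _*_ = _*_ ; -_ = -_ ; 0# = 0# ; 1# = 1#
    ; isCommutativeRing = isCommutativeRing }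

  open GroupProperties (CommutativeRing.+-group commutativeRing) public
    using (//-rightDividesˡ; //-rightDividesʳ)
  open ProductProperties (CommutativeRing.*-commutativeMonoid commutativeRing) public
    using (sum-remove; ∑-permute; ∑-distrib-+; sum-cong-≗)
    renaming (sum to ∏)

  _≟_ : DecidableEquality Carrier
  _≟_ = via-injection (↔⇒↣ (↔-sym enumeration)) Fin._≟_

  *-cancelˡ : ∀ {x y z} → x ≢ 0# → x * y ≡ x * z → y ≡ z
  *-cancelˡ {x} {y} {z} x≢0 xy≡xz = begin
    y             ≡⟨ sym (*-identityˡ y) ⟩
    1# * y        ≡⟨ cong (_* y) x⁻¹*x≡1 ⟨
    x⁻¹ * x * y   ≡⟨ *-assoc x⁻¹ x y ⟩
    x⁻¹ * (x * y) ≡⟨ cong (x⁻¹ *_) xy≡xz ⟩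
    x⁻¹ * (x * z) ≡⟨ *-assoc x⁻¹ x z ⟨
    x⁻¹ * x * z   ≡⟨ cong (_* z) x⁻¹*x≡1 ⟩
    1# * z        ≡⟨ *-identityˡ z ⟩
    z             ∎
    where
    open ≡-Reasoning
    x⁻¹ : Carrier
    x⁻¹ = proj₁ (inverse x x≢0)
    x⁻¹*x≡1 : x⁻¹ * x ≡ 1#
    x⁻¹*x≡1 = trans (*-comm x⁻¹ x) (proj₂ (inverse x x≢0))

  *-≢0 : ∀ {x y} → x ≢ 0# → y ≢ 0# → x * y ≢ 0#
  *-≢0 {x} x≢0 y≢0 xy≡0 = y≢0 (*-cancelˡ x≢0 (trans xy≡0 (sym (zeroʳ x))))

  ∏-const : ∀ n x → ∏ {n} (λ _ → x) ≡ x ^ᶠ n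
  ∏-const zero    x = refl
  ∏-const (suc n) x = cong (x *_) (∏-const n x)

  ∏-≢0 : ∀ {n} (v : Vector Carrier n) → (∀ j → v j ≢ 0#) → ∏ v ≢ 0#
  ∏-≢0 {zero}  v v≢0 ∏≡0 = 0≢1 (sym ∏≡0)
  ∏-≢0 {suc n} v v≢0 = *-≢0 (v≢0 fzero) (∏-≢0 (tail v) (v≢0 ∘ fsuc))

  *-↔ : ∀ {x} → x ≢ 0# → Carrier ↔ Carrier
  *-↔ {x} x≢0 = mk↔ₛ′ (x *_) (x⁻¹ *_)
      (λ y → cancel x x⁻¹ y x*x⁻¹≡1)
      (λ y → cancel x⁻¹ x y (trans (*-comm x⁻¹ x) x*x⁻¹≡1))
    where
    x⁻¹ : Carrier
    x⁻¹ = proj₁ (inverse x x≢0)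
    x*x⁻¹≡1 : x * x⁻¹ ≡ 1#
    x*x⁻¹≡1 = proj₂ (inverse x x≢0)
    cancel : ∀ u v y → u * v ≡ 1# → u * (v * y) ≡ y
    cancel u v y uv≡1 = trans (sym (*-assoc u v y)) (trans (cong (_* y) uv≡1) (*-identityˡ y))

-- Fermat's little theorem. Multiplication by x ≢ 0 permutes the field; once 0 is replaced
-- by 1, the product over the whole field is the product P of the nonzero elements, so P = x^(q-1) P.
module Fermat {m : ℕ} (K : FiniteField (suc m)) where
  open FiniteFieldProperties K

  private
    to : Fin (suc m) → Carrier
    to = Inverse.to enumeration

    from : Carrier → Fin (suc m)
    from = Inverse.from enumeration

    to-from : ∀ y → to (from y) ≡ y
    to-from y = Inverse.strictlyInverseˡ enumeration y

    zeroIndex : Fin (suc m)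
    zeroIndex = from 0#

    replaceZero : Carrier → Carrier
    replaceZero y with y ≟ 0#
    ... | yes _ = 1#
    ... | no  _ = y

    replaceZero-≢0 : ∀ {y} → y ≢ 0# → replaceZero y ≡ y
    replaceZero-≢0 {y} y≢0 with y ≟ 0#
    ... | yes y≡0 = ⊥-elim (y≢0 y≡0)
    ... | no  _   = refl

    ∏-replaceZero : (f : Vector Carrier (suc m)) → f zeroIndex ≡ 0# →
                    (∀ j → f (punchIn zeroIndex j) ≢ 0#) →
                    ∏ (replaceZero ∘ f) ≡ ∏ (removeAt f zeroIndex)
    ∏-replaceZero f f0≡0 f≢0 = begin
      ∏ (replaceZero ∘ f)
        ≡⟨ sum-remove (replaceZero ∘ f) ⟩
      replaceZero (f zeroIndex) * ∏ (removeAt (replaceZero ∘ f) zeroIndex)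
        ≡⟨ cong₂ _*_ (trans (cong replaceZero f0≡0) replaceZero-0) (sum-cong-≗ (replaceZero-≢0 ∘ f≢0)) ⟩
      1# * ∏ (removeAt f zeroIndex)
        ≡⟨ *-identityˡ _ ⟩
      ∏ (removeAt f zeroIndex)
        ∎
      where
      open ≡-Reasoning
      replaceZero-0 : replaceZero 0# ≡ 1#
      replaceZero-0 with 0# ≟ 0#
      ... | yes _   = refl
      ... | no  0≢0 = ⊥-elim (0≢0 refl)

    nonzero : Vector Carrier m
    nonzero = removeAt to zeroIndex

    nonzero-≢0 : ∀ j → nonzero j ≢ 0#
    nonzero-≢0 j ≡0 = punchInᵢ≢i zeroIndex j
      (trans (sym (Inverse.strictlyInverseʳ enumeration _)) (cong from ≡0))

  fermat : ∀ x → x ≢ 0# → x ^ᶠ m ≡ 1#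
  fermat x x≢0 = sym (*-cancelˡ (∏-≢0 nonzero nonzero-≢0) (begin
    ∏ nonzero * 1#                               ≡⟨ *-identityʳ _ ⟩
    ∏ nonzero                                    ≡⟨ ∏-replaceZero to (to-from 0#) nonzero-≢0 ⟨
    ∏ (replaceZero ∘ to)                         ≡⟨ ∑-permute (replaceZero ∘ to) scaling ⟩
    ∏ (replaceZero ∘ to ∘ (scaling ⟨$⟩ʳ_))       ≡⟨ sum-cong-≗ (λ i → cong replaceZero (to-from (x * to i))) ⟩
    ∏ (replaceZero ∘ (x *_) ∘ to)                ≡⟨ ∏-replaceZero ((x *_) ∘ to) x*0≡0 (*-≢0 x≢0 ∘ nonzero-≢0) ⟩
    ∏ (λ j → x * nonzero j)                      ≡⟨ ∑-distrib-+ (λ _ → x) nonzero ⟩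
    ∏ {m} (λ _ → x) * ∏ nonzero                  ≡⟨ cong (_* ∏ nonzero) (∏-const m x) ⟩
    x ^ᶠ m * ∏ nonzero                           ≡⟨ *-comm (x ^ᶠ m) (∏ nonzero) ⟩
    ∏ nonzero * x ^ᶠ m                           ∎))
    where
    open ≡-Reasoning
    scaling : Permutation′ (suc m)
    scaling = ↔-trans enumeration (↔-trans (*-↔ x≢0) (↔-sym enumeration))
    x*0≡0 : x * to zeroIndex ≡ 0#
    x*0≡0 = trans (cong (x *_) (to-from 0#)) (zeroʳ x)

module Recursion {q : ℕ} (K : FiniteField q) where
  open FiniteField K
  open Maps K

  entry-one : ∀ {k} (a : Vector Carrier (suc k)) → entry a 1 ≡ head a
  entry-one {k} a with 0 <? suc k
  ... | yes _   = refl
  ... | no  0≮k = ⊥-elim (0≮k (s≤s z≤n))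

  entry-tail : ∀ {k} (a : Vector Carrier (suc k)) m →
               entry a (suc (suc m)) ≡ entry (tail a) (suc m)
  entry-tail {k} a m with suc m <? suc k | m <? k
  ... | yes m<k′        | yes m<k = cong a (toℕ-injective
          (trans (toℕ-fromℕ< m<k′) (cong suc (sym (toℕ-fromℕ< m<k)))))
  ... | yes (s≤s m<k)   | no m≮k  = ⊥-elim (m≮k m<k)
  ... | no m≮k′         | yes m<k = ⊥-elim (m≮k′ (s≤s m<k))
  ... | no _            | no _    = refl

  entry-shift : ∀ {k} (a : Vector Carrier (suc k)) i j → j < i →
                entry a (suc i ∸ j) ≡ entry (tail a) (i ∸ j)
  entry-shift a (suc i) zero    _         = entry-tail a i
  entry-shift a (suc i) (suc j) (s≤s j<i) = entry-shift a i j j<i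

  c-tail : ∀ {k} (a : Vector Carrier (suc k)) i j → j ≤ i → c a (suc i) j ≡ c (tail a) i j
  c-tail a i zero    _   = refl
  c-tail a i (suc j) j<i = cong₂ _+_ (cong inv (c-tail a i j (<⇒≤ j<i))) (entry-shift a i j j<i)

  F-fsuc : ∀ {k} (a : Vector Carrier (suc k)) t → F a (fsuc t) ≡ inv (F (tail a) t) + head a
  F-fsuc a t = cong₂ _+_
    (cong inv (c-tail a (suc (toℕ t)) (suc (toℕ t)) ≤-refl))
    (trans (cong (entry a) (m+n∸n≡m 1 (toℕ t))) (entry-one a))

module Inversion (n : ℕ) (K : FiniteField (suc (suc (suc n)))) where
  open FiniteFieldProperties K
  open Maps K
  open Recursion K

  inv-zero : inv 0# ≡ 0#
  inv-zero = zeroˡ _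

  x*inv-x≡1 : ∀ {x} → x ≢ 0# → x * inv x ≡ 1#
  x*inv-x≡1 {x} = Fermat.fermat K x

  inv-involutive : ∀ x → inv (inv x) ≡ x
  inv-involutive x with x ≟ 0#
  ... | yes refl = trans (cong inv inv-zero) inv-zero
  ... | no  x≢0  = *-cancelˡ inv-x≢0
        (trans (x*inv-x≡1 inv-x≢0) (trans (sym (x*inv-x≡1 x≢0)) (*-comm x (inv x))))
    where
    inv-x≢0 : inv x ≢ 0#
    inv-x≢0 inv-x≡0 = 0≢1 (trans (sym (zeroʳ x)) (trans (cong (x *_) (sym inv-x≡0)) (x*inv-x≡1 x≢0)))

  F-fzero : ∀ {k} (a : Vector Carrier (suc k)) → F a fzero ≡ head a
  F-fzero a = trans (cong₂ _+_ inv-zero (entry-one a)) (+-identityˡ (head a))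

  Φ∘F : ∀ {k} (a : Vector Carrier (suc k)) j → Φ (F a) j ≡ F (tail a) j
  Φ∘F a j = begin
    inv (F a (fsuc j) - F a fzero)                   ≡⟨ cong inv (cong₂ _-_ (F-fsuc a j) (F-fzero a)) ⟩
    inv ((inv (F (tail a) j) + head a) - head a)     ≡⟨ cong inv (//-rightDividesʳ (head a) _) ⟩
    inv (inv (F (tail a) j))                         ≡⟨ inv-involutive _ ⟩
    F (tail a) j                                     ∎
    where open ≡-Reasoning

  G-cong : ∀ {k} {b b′ : Vector Carrier k} → (∀ t → b t ≡ b′ t) → ∀ t → G b t ≡ G b′ t
  G-cong {suc k} b≗b′ fzero    = b≗b′ fzero
  G-cong {suc k} b≗b′ (fsuc t) = G-cong (λ j → cong inv (cong₂ _-_ (b≗b′ (fsuc j)) (b≗b′ fzero))) t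

  G∘F : ∀ k (a : Vector Carrier k) t → G (F a) t ≡ a t
  G∘F (suc k) a fzero    = F-fzero a
  G∘F (suc k) a (fsuc t) = trans (G-cong (Φ∘F a) t) (G∘F k (tail a) t)

  F∘G : ∀ k (b : Vector Carrier k) t → F (G b) t ≡ b t
  F∘G (suc k) b fzero    = F-fzero (G b)
  F∘G (suc k) b (fsuc t) = begin
    F (G b) (fsuc t)                         ≡⟨ F-fsuc (G b) t ⟩
    inv (F (G (Φ b)) t) + head b             ≡⟨ cong (λ y → inv y + head b) (F∘G k (Φ b) t) ⟩
    inv (inv (b (fsuc t) - head b)) + head b ≡⟨ cong (_+ head b) (inv-involutive _) ⟩
    (b (fsuc t) - head b) + head b           ≡⟨ //-rightDividesˡ (head b) (b (fsuc t)) ⟩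
    b (fsuc t)                               ∎
    where open ≡-Reasoning

theorem3p1 : (q : ℕ) → IsPrimePower q → 2 < q → (K : FiniteField q) →
    (k : ℕ) → 1 ≤ k →
    ((a : Fin k → FiniteField.Carrier K) → ∀ t → Maps.G K (Maps.F K a) t ≡ a t)
    × ((b : Fin k → FiniteField.Carrier K) → ∀ t → Maps.F K (Maps.G K b) t ≡ b t)
theorem3p1 (suc (suc (suc n))) _ (s≤s (s≤s (s≤s _))) K k _ =
  Inversion.G∘F n K k , Inversion.F∘G n K k
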